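{- Let $k,s,t$ be integers with $2 \leq k < s$ and $k < t$, and let $m = \tilde{r}_{k-1}(s-1,t-1)$. Then in the $2$-color $k$-uniform vertex online Ramsey game for cliques of sizes $s$ and $t$, builder has a strategy that, against every painter strategy, forces painter to create a copy of $K_s^{(k)}$ all of whose edges have color $1$ or a copy of $K_t^{(k)}$ all of whose edges have color $2$, while revealing at most $2^m + k - 2$ vertices and building at most $m \cdot 2^m$ edges. In particular, \[ r_k(s,t) \leq 2^{\tilde{r}_{k-1}(s-1,t-1)} + k - 2 \] and \[ \tilde{r}_k(s,t) \leq \tilde{r}_{k-1}(s-1,t-1) \cdot 2^{\tilde{r}_{k-1}(s-1,t-1)} = 2^{(1+o(1))\tilde{r}_{k-1}(s-1,t-1)}, \] where the $o(1)$ term tends to $0$ as $\max\{s,t\}\to\infty$.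
   Context: $K_n^{(k)}$ denotes the complete $k$-uniform hypergraph on $n$ vertices. For integers $k < t_1,\dots,t_q$, the Ramsey number $r_k(t_1,\dots,t_q)$ is the least $n$ such that every $q$-coloring of the edges of $K_n^{(k)}$ contains, for some color $c\in[q]$, a copy of $K_{t_c}^{(k)}$ all of whose edges have color $c$. The $q$-color $k$-uniform vertex online Ramsey game for cliques of sizes $t_1,\dots,t_q$ (with $k<t_1,\dots,t_q$) is played by builder and painter on an ordered vertex set $v_1,v_2,\dots$ of an initially empty $k$-uniform hypergraph, in rounds. At the start of round $i$ the vertex $v_i$ is revealed. During round $i$, builder may build any number of edges of the form $\{v_{i_1},\dots,v_{i_{k-1}},v_i\}$ with $i_1<\dots<i_{k-1}<i$, in any order (adaptively); whenever an edge is built, painter must immediately assign it a color from $[q]$. In each round $i\geq k$ builder must build at least one new edge. Builder's goal is to force, for some $c\in[q]$, a copy of $K_{t_c}^{(k)}$ all of whose edges are built and have color $c$; painter tries to delay this. The $k$-uniform vertex online Ramsey number $\tilde{r}_k(t_1,\dots,t_q)$ is the minimum number of edges builder must build to force such a monochromatic clique against any painter strategy. For $q=2$ write $\tilde{r}_k(s,t)$ and $r_k(s,t)$ (cliques of size $s$ in color $1$ and size $t$ in color $2$). These definitions are also used for uniformity $1$ (when $k=2$, the quantity $\tilde r_{1}$ appears). -}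

module Defs where

open import Data.Nat using (ℕ; zero; suc; _+_; _*_; _∸_; _^_; _≤_; _<_)
open import Data.Fin using (Fin; zero; suc)
open import Data.Bool using (Bool; true; false)
open import Data.List using (List; []; _∷_; _∷ʳ_; length; map)
open import Data.List.Membership.Propositional using (_∈_; _∉_)
open import Data.List.Relation.Unary.AllPairs using (AllPairs)
open import Data.List.Relation.Binary.Sublist.Propositional using (_⊆_)
open import Data.Product using (Σ; _×_; _,_; proj₁; ∃)
open import Data.Sum using (_⊎_)
open import Relation.Binary.PropositionalEquality using (_≡_)

-- Vertices v_1, v_2, ... are encoded as 0, 1, 2, ... (v_i ↦ i - 1).
-- A set of vertices (in particular an edge) is encoded as a strictly
-- increasing list of naturals.  Colours: Fin 2, colour 1 = zero, colour 2 = suc zero.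

Colour : Set
Colour = Fin 2

size : ℕ → ℕ → Colour → ℕ
size s t zero    = s
size s t (suc _) = t

Increasing : List ℕ → Set
Increasing = AllPairs _<_

Built : Set
Built = List (List ℕ × Colour)

MonoClique : (k s t : ℕ) → Built → Set
MonoClique k s t built =
  Σ Colour λ c → Σ (List ℕ) λ S →
    Increasing S × length S ≡ size s t c ×
    (∀ e → e ⊆ S → length e ≡ k → (e , c) ∈ built)

-- An admissible edge in the round where n vertices have been revealed
-- (current vertex is n - 1): a k-set whose largest vertex is the current one.
ValidEdge : (k n : ℕ) → List ℕ → Set
ValidEdge k n e =
  Increasing e × length e ≡ k ×
  Σ ℕ λ v → suc v ≡ n × Σ (List ℕ) λ xs → e ≡ xs ∷ʳ v

-- Win k s t V E n built b :
--   in the 2-colour k-uniform vertex online Ramsey game for cliques of sizes s,t,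
--   from the position where n vertices are revealed, the edges in 'built' have
--   been built and coloured, and b records whether an edge has been built in the
--   current round, builder has a strategy which, against every painter,
--   forces a monochromatic clique while building at most E further edges and
--   never having more than V vertices revealed in total.
data Win (k s t V : ℕ) : (E n : ℕ) → Built → Bool → Set where
  won   : ∀ {E n built b} → MonoClique k s t built → Win k s t V E n built b
  build : ∀ {E n built b} (e : List ℕ) → ValidEdge k n e → e ∉ map proj₁ built →
          (∀ (c : Colour) → Win k s t V E n ((e , c) ∷ built) true) →
          Win k s t V (suc E) n built b
  -- end the current round and reveal the next vertex; allowed only if an edge
  -- was built in this round or the round index n is < k
  next  : ∀ {E n built b} → (b ≡ true ⊎ n < k) → suc n ≤ V →
          Win k s t V E (suc n) built false → Win k s t V E n built b

BuilderWins : (k s t V E : ℕ) → Set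
BuilderWins k s t V E = Win k s t V E 0 [] false

IsOnlineRamseyNumber : (k s t m : ℕ) → Set
IsOnlineRamseyNumber k s t m =
  (∃ λ V → BuilderWins k s t V m) ×
  (∀ m′ → (∃ λ V → BuilderWins k s t V m′) → m ≤ m′)

Arrows : (k s t n : ℕ) → Set
Arrows k s t n =
  ∀ (col : List ℕ → Colour) →
    Σ Colour λ c → Σ (List ℕ) λ S →
      Increasing S × (∀ x → x ∈ S → x < n) × length S ≡ size s t c ×
      (∀ e → e ⊆ S → length e ≡ k → col e ≡ c)

IsRamseyNumber : (k s t r : ℕ) → Set
IsRamseyNumber k s t r = Arrows k s t r × (∀ n → Arrows k s t n → r ≤ n)

-- Builder fixes a winning strategy W for the (k-1)-uniform game with cliques of sizes s-1 and
-- t-1, and first reveals k-1 vertices, identified with the first k-1 vertices of W.  Every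
-- further vertex v then walks down W: an edge e of W is played as the k-edge φ(e) ∪ {v}, and
-- painter's colour for it picks the branch of W.  At a reveal of W, if an earlier vertex u
-- occupies that slot, v continues with the new vertex of W mapped to u; otherwise v occupies
-- the slot and the next vertex starts.  Since u walked the same branch, φ(e) ∪ {u} has the
-- colour of e for every edge e of W older than that reveal, so when v reaches a leaf of W with
-- a monochromatic clique S, φ(S) ∪ {v} is a monochromatic clique.  W has at most 2^m - 2 slots
-- and every vertex builds at most m edges.

{-# OPTIONS --safe #-}
module Submission where

open import Defs
open import Data.Bool using (Bool; true; false)
open import Data.Empty using (⊥-elim)
open import Data.Fin using (zero; suc)
open import Data.List.Base using (List; []; _∷_; _∷ʳ_; length; map; take; [_]; initLast; _∷ʳ′_)
open import Data.List.Properties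
  using (length-++; length-map; length-take; map-++; map-cong-local; ∷-injective; ∷ʳ-injectiveˡ)
open import Data.List.Membership.Propositional using (_∈_; _∉_)
open import Data.List.Membership.Propositional.Properties using (∈-map⁺; ∈-map⁻; ∈-++⁺ʳ)
open import Data.List.Relation.Unary.Any using (here; there)
open import Data.List.Relation.Unary.All as All using (All; []; _∷_)
import Data.List.Relation.Unary.All.Properties as Allₚ
open import Data.List.Relation.Unary.AllPairs using (AllPairs; []; _∷_)
open import Data.List.Relation.Binary.Sublist.Propositional
  using (_⊆_; []; _∷_; lookup; ⊆-refl; ⊆-trans) renaming (_∷ʳ_ to skip)
open import Data.List.Relation.Binary.Sublist.Propositional.Properties using (take-⊆; ++⁺; ++⁺ʳ)
import Data.List.Relation.Binary.Subset.Propositional as Subset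
open import Data.Maybe using (Maybe; just; nothing)
open import Data.Nat using (ℕ; zero; suc; _+_; _*_; _∸_; _^_; _≤_; _<_; z≤n; s≤s; _<?_)
open import Data.Nat.Properties
open import Data.Product using (∃₂; ∃-syntax; _×_; _,_; proj₁; proj₂)
import Data.Product as Product
open import Data.Sum using (_⊎_; inj₁; inj₂)
open import Data.Unit using (⊤; tt)
open import Function using (id; _∘_)
open import Relation.Binary.Definitions using (tri<; tri≈; tri>)
open import Relation.Binary.PropositionalEquality using (_≡_; refl; sym; trans; cong; cong₂; subst)
open import Relation.Nullary using (¬_; yes; no)

private variable
  A A′ : Set

length-∷ʳ : ∀ (xs : List A) x → length (xs ∷ʳ x) ≡ suc (length xs)
length-∷ʳ xs x = trans (length-++ xs) (+-comm (length xs) 1)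

∈-∷ʳ : ∀ (xs : List A) x → x ∈ xs ∷ʳ x
∈-∷ʳ xs x = ∈-++⁺ʳ xs (here refl)

All-⊆ : ∀ {P : A → Set} {xs ys} → xs ⊆ ys → All P ys → All P xs
All-⊆ τ = Allₚ.anti-mono (lookup τ)

AllPairs-⊆ : ∀ {R : A → A → Set} {xs ys} → xs ⊆ ys → AllPairs R ys → AllPairs R xs
AllPairs-⊆ []         []       = []
AllPairs-⊆ (skip _ τ) (_ ∷ rs) = AllPairs-⊆ τ rs
AllPairs-⊆ (refl ∷ τ) (r ∷ rs) = All-⊆ τ r ∷ AllPairs-⊆ τ rs

⊆-∷ʳ⁻ : ∀ {xs} (ys : List A) {v} → xs ⊆ ys ∷ʳ v →
        xs ⊆ ys ⊎ ∃[ xs′ ] (xs ≡ xs′ ∷ʳ v × xs′ ⊆ ys)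
⊆-∷ʳ⁻ []       (skip _ []) = inj₁ []
⊆-∷ʳ⁻ []       (refl ∷ []) = inj₂ ([] , refl , [])
⊆-∷ʳ⁻ (y ∷ ys) (skip _ τ) with ⊆-∷ʳ⁻ ys τ
... | inj₁ τ′                 = inj₁ (skip y τ′)
... | inj₂ (xs′ , refl , τ′)  = inj₂ (xs′ , refl , skip y τ′)
⊆-∷ʳ⁻ (y ∷ ys) (refl ∷ τ) with ⊆-∷ʳ⁻ ys τ
... | inj₁ τ′                 = inj₁ (refl ∷ τ′)
... | inj₂ (xs′ , refl , τ′)  = inj₂ (y ∷ xs′ , refl , refl ∷ τ′)

⊆-map⁻ : ∀ (f : A → A′) {xs} ys → xs ⊆ map f ys → ∃[ zs ] (zs ⊆ ys × xs ≡ map f zs)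
⊆-map⁻ f []       []         = [] , [] , refl
⊆-map⁻ f (y ∷ ys) (skip _ τ) with ⊆-map⁻ f ys τ
... | zs , τ′ , eq   = zs , skip y τ′ , eq
⊆-map⁻ f (y ∷ ys) (refl ∷ τ) with ⊆-map⁻ f ys τ
... | zs , τ′ , refl = y ∷ zs , refl ∷ τ′ , refl

Increasing-∷ʳ⁻ : ∀ xs {j} → Increasing (xs ∷ʳ j) → All (_< j) xs
Increasing-∷ʳ⁻ []       _             = []
Increasing-∷ʳ⁻ (x ∷ xs) (x<xs∷j ∷ inc) = proj₂ (Allₚ.∷ʳ⁻ x<xs∷j) ∷ Increasing-∷ʳ⁻ xs inc

Increasing-length : ∀ {a b} ys → Increasing ys → All (a ≤_) ys → All (_< b) ys → a ≤ b →
                    a + length ys ≤ b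
Increasing-length {a} []       _ _ _ a≤b = ≤-trans (≤-reflexive (+-identityʳ a)) a≤b
Increasing-length {a} {b} (y ∷ ys) (y<ys ∷ inc) (a≤y ∷ _) (y<b ∷ ys<b) _ = begin
  a + suc (length ys)  ≡⟨ +-suc a (length ys) ⟩
  suc (a + length ys)  ≤⟨ s≤s (+-monoˡ-≤ (length ys) a≤y) ⟩
  suc y + length ys    ≤⟨ Increasing-length ys inc y<ys ys<b y<b ⟩
  b                    ∎
  where open ≤-Reasoning

module _ {n : ℕ} {φ : ℕ → ℕ} (increasing : ∀ {i j} → i < j → j < n → φ i < φ j) where

  map-∷ʳ-increasing : ∀ {v xs} → (∀ {i} → i < n → φ i < v) →
                      Increasing xs → All (_< n) xs → Increasing (map φ xs ∷ʳ v)
  map-∷ʳ-increasing below []             []           = [] ∷ []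
  map-∷ʳ-increasing below (x<xs ∷ inc) (x<n ∷ xs<n) =
    Allₚ.∷ʳ⁺ (Allₚ.map⁺ (All.zipWith (Product.uncurry increasing) (x<xs , xs<n))) (below x<n)
      ∷ map-∷ʳ-increasing below inc xs<n

  injective-below : ∀ {i j} → i < n → j < n → φ i ≡ φ j → i ≡ j
  injective-below {i} {j} i<n j<n φi≡φj with <-cmp i j
  ... | tri< i<j _ _ = ⊥-elim (<-irrefl φi≡φj (increasing i<j j<n))
  ... | tri≈ _ i≡j _ = i≡j
  ... | tri> _ _ j<i = ⊥-elim (<-irrefl (sym φi≡φj) (increasing j<i i<n))

  map-injective-below : ∀ {xs ys} → All (_< n) xs → All (_< n) ys → map φ xs ≡ map φ ys → xs ≡ ys
  map-injective-below []           []           _  = refl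
  map-injective-below (x<n ∷ xs<n) (y<n ∷ ys<n) eq =
    cong₂ _∷_ (injective-below x<n y<n (proj₁ (∷-injective eq)))
              (map-injective-below xs<n ys<n (proj₂ (∷-injective eq)))
  map-injective-below [] (_ ∷ _) ()
  map-injective-below (_ ∷ _) [] ()

extend : (ℕ → ℕ) → ℕ → ℕ → ℕ → ℕ
extend φ n u i with i <? n
... | yes _ = φ i
... | no  _ = u

extend-< : ∀ φ {n u i} → i < n → extend φ n u i ≡ φ i
extend-< φ {n} {u} {i} i<n with i <? n
... | yes _   = refl
... | no  i≮n = ⊥-elim (i≮n i<n)

extend-≡ : ∀ φ n u → extend φ n u n ≡ u
extend-≡ φ n u with n <? n
... | yes n<n = ⊥-elim (<-irrefl refl n<n)
... | no  _   = refl

map-extend : ∀ φ {n u xs} → All (_< n) xs → map (extend φ n u) xs ≡ map φ xs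
map-extend φ xs<n = map-cong-local (All.map (extend-< φ) xs<n)

size-suc : ∀ s t c → size (suc s) (suc t) c ≡ suc (size s t c)
size-suc s t zero       = refl
size-suc s t (suc zero) = refl

size-≥ : ∀ {k s t} → k ≤ s → k ≤ t → ∀ c → k ≤ size s t c
size-≥ k≤s k≤t zero       = k≤s
size-≥ k≤s k≤t (suc zero) = k≤t

Bounded : Built → ℕ → Set
Bounded B n = ∀ {e c} → (e , c) ∈ B → All (_< n) e

Bounded-mono : ∀ {B m n} → m ≤ n → Bounded B m → Bounded B n
Bounded-mono m≤n bounded e∈ = All.map (λ x<m → <-≤-trans x<m m≤n) (bounded e∈)

Bounded-∷ : ∀ {B n e c} → All (_< n) e → Bounded B n → Bounded ((e , c) ∷ B) n
Bounded-∷ e<n _       (here refl) = e<n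
Bounded-∷ _   bounded (there e∈)  = bounded e∈

ValidEdge-bounded : ∀ {k n e} → ValidEdge k n e → All (_< n) e
ValidEdge-bounded (inc , _ , v , refl , xs , refl) =
  Allₚ.∷ʳ⁺ (All.map m<n⇒m<1+n (Increasing-∷ʳ⁻ xs inc)) (n<1+n v)

ValidEdge-length : ∀ {k n e} → ValidEdge k n e → k ≤ n
ValidEdge-length {e = e} ve@(inc , |e| , _) =
  subst (_≤ _) |e| (Increasing-length e inc (All.tabulate (λ _ → z≤n)) (ValidEdge-bounded ve) z≤n)

ValidEdge-not-below : ∀ {k n e i} → ValidEdge k n e → i < n → ¬ All (_< i) e
ValidEdge-not-below (_ , _ , v , refl , xs , refl) i<1+v e<i =
  <⇒≱ (proj₂ (Allₚ.∷ʳ⁻ e<i)) (≤-pred i<1+v)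

-- The j-subset made of the last vertex of S and j - 1 others bounds all of S.
clique-bounded : ∀ {j N} S → 1 ≤ j → j ≤ length S → Increasing S →
                 (∀ e → e ⊆ S → length e ≡ j → All (_< N) e) → All (_< N) S
clique-bounded {suc j} {N} S _ j<S inc edges-bounded with initLast S
clique-bounded {suc j} {N} .[] _ () _ _ | []
... | S₀ ∷ʳ′ y = Allₚ.∷ʳ⁺ (All.map (λ x<y → <-trans x<y y<N) (Increasing-∷ʳ⁻ S₀ inc)) y<N
  where
  j≤S₀ : j ≤ length S₀
  j≤S₀ = ≤-pred (subst (suc j ≤_) (length-∷ʳ S₀ y) j<S)
  |e| : length (take j S₀ ∷ʳ y) ≡ suc j
  |e| = trans (length-∷ʳ (take j S₀) y) (cong suc (trans (length-take j S₀) (m≤n⇒m⊓n≡m j≤S₀)))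
  y<N : y < N
  y<N = proj₂ (Allₚ.∷ʳ⁻ (edges-bounded (take j S₀ ∷ʳ y) (++⁺ (take-⊆ j S₀) ⊆-refl) |e|))

¬MonoClique-[] : ∀ {k s t} → k ≤ s → k ≤ t → ¬ MonoClique k s t []
¬MonoClique-[] {k} k≤s k≤t (c , S , _ , |S| , edges)
  with edges (take k S) (take-⊆ k S)
             (trans (length-take k S) (m≤n⇒m⊓n≡m (subst (k ≤_) (sym |S|) (size-≥ k≤s k≤t c))))
... | ()

Painted : (List ℕ → Colour) → Built → Set
Painted col B = ∀ {e c} → (e , c) ∈ B → col e ≡ c

Win-paint : ∀ {k s t V E n B b} → Win k s t V E n B b → (col : List ℕ → Colour) →
            Painted col B → Bounded B n → n ≤ V →
            ∃[ B′ ] (MonoClique k s t B′ × Painted col B′ × Bounded B′ V)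
Win-paint (won S)          _   painted bounded n≤V = _ , S , painted , Bounded-mono n≤V bounded
Win-paint (build e ve _ W) col painted bounded n≤V =
  Win-paint (W (col e)) col painted′ (Bounded-∷ (ValidEdge-bounded ve) bounded) n≤V
  where
  painted′ : Painted col ((e , col e) ∷ _)
  painted′ (here refl) = refl
  painted′ (there e∈)  = painted e∈
Win-paint (next _ 1+n≤V W) col painted bounded _ =
  Win-paint W col painted (Bounded-mono (n≤1+n _) bounded) 1+n≤V

BuilderWins⇒Arrows : ∀ {k s t V E} → 1 ≤ k → k ≤ s → k ≤ t → BuilderWins k s t V E → Arrows k s t V
BuilderWins⇒Arrows {V = V} 1≤k k≤s k≤t W col with Win-paint W col (λ ()) (λ ()) z≤n
... | _ , (c , S , inc , |S| , edges) , painted , bounded =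
  c , S , inc , (λ _ → All.lookup S<V) , |S| , (λ e e⊆S |e| → painted (edges e e⊆S |e|))
  where
  S<V : All (_< V) S
  S<V = clique-bounded S 1≤k (subst (_ ≤_) (sym |S|) (size-≥ k≤s k≤t c)) inc
          (λ e e⊆S |e| → bounded (edges e e⊆S |e|))

update : ∀ {P : Colour → Set} (c : Colour) → P c → ((c′ : Colour) → P c′) → (c′ : Colour) → P c′
update zero       x f zero       = x
update zero       x f (suc zero) = f (suc zero)
update (suc zero) x f zero       = f zero
update (suc zero) x f (suc zero) = x

1+m+n<2*o : ∀ {m n o} → m < o → n < o → suc (m + n) < 2 * o
1+m+n<2*o {m} {n} {o} m<o n<o = begin
  suc (suc (m + n)) ≡⟨ cong suc (sym (+-suc m n)) ⟩
  suc m + suc n     ≤⟨ +-mono-≤ m<o n<o ⟩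
  o + o             ≡⟨ cong (o +_) (sym (+-identityʳ o)) ⟩
  2 * o             ∎
  where open ≤-Reasoning

module Lifting (k s t V′ V : ℕ) (1≤k : 1 ≤ k) (k<s : k < s) (k<t : k < t) where

  Low : ℕ → ℕ → Built → Bool → Set
  Low = Win k s t V′

  High : ℕ → ℕ → Built → Bool → Set
  High = Win (suc k) (suc s) (suc t) V

  private variable
    E Eₕ M N N′ n u v : ℕ
    b bb : Bool
    B bk bk′ : Built
    φ : ℕ → ℕ
    e : List ℕ

  Linked : (ℕ → ℕ) → ℕ → Built → Built → Set
  Linked φ u bk B = ∀ {e c} → (e , c) ∈ B → (map φ e ∷ʳ u , c) ∈ bk

  -- The state of vertex v walking down the low strategy at a position with n low vertices and
  -- low edges B: low vertex i is the high vertex φ i (an opening vertex, or the occupant of the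
  -- i-th slot of this branch), each occupant is linked to the low edges older than its slot,
  -- and the high edges through v are exactly the links of v to B.
  record Descent (φ : ℕ → ℕ) (n : ℕ) (B : Built) (v : ℕ) (bk : Built) : Set where
    field
      increasing       : ∀ {i j} → i < j → j < n → φ i < φ j
      below            : ∀ {i} → i < n → φ i < v
      occupants-linked : ∀ {e c} → (e , c) ∈ B → ∀ {i} → All (_< i) e → i < n →
                         (map φ e ∷ʳ φ i , c) ∈ bk
      linked           : Linked φ v bk B
      low-bounded      : Bounded B n
      only-links       : ∀ {x c} → (x , c) ∈ bk → v ∈ x →
                         ∃₂ λ e c′ → (e , c′) ∈ B × x ≡ map φ e ∷ʳ v
      high-bounded     : Bounded bk (suc v)

  Descent-initial : k ≤ N → Bounded bk N → Descent id k [] N bk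
  Descent-initial k≤N bk<N = record
    { increasing       = λ i<j _ → i<j
    ; below            = λ i<k → <-≤-trans i<k k≤N
    ; occupants-linked = λ ()
    ; linked           = λ ()
    ; low-bounded      = λ ()
    ; only-links       = λ x∈bk N∈x → ⊥-elim (<-irrefl refl (All.lookup (bk<N x∈bk) N∈x))
    ; high-bounded     = Bounded-mono (n≤1+n _) bk<N
    }

  lift-valid : Descent φ n B v bk → ValidEdge k n e → ValidEdge (suc k) (suc v) (map φ e ∷ʳ v)
  lift-valid {φ} {v = v} {e = e} D ve@(inc , |e| , _) =
    map-∷ʳ-increasing increasing below inc (ValidEdge-bounded ve) ,
    trans (length-∷ʳ (map φ e) v) (cong suc (trans (length-map φ e) |e|)) ,
    v , refl , map φ e , refl
    where open Descent D

  lift-fresh : Descent φ n B v bk → ValidEdge k n e → e ∉ map proj₁ B →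
               map φ e ∷ʳ v ∉ map proj₁ bk
  lift-fresh {φ} {v = v} {e = e} D ve e∉B x∈bk with ∈-map⁻ proj₁ x∈bk
  ... | (x , _) , xc∈bk , x≡
    with Descent.only-links D xc∈bk (subst (v ∈_) x≡ (∈-∷ʳ (map φ e) v))
  ...   | e′ , c′ , e′∈B , x≡′ = e∉B (subst (_∈ _) (sym e≡e′) (∈-map⁺ proj₁ e′∈B))
    where
    open Descent D
    e≡e′ : e ≡ e′
    e≡e′ = map-injective-below increasing (ValidEdge-bounded ve) (low-bounded e′∈B)
             (∷ʳ-injectiveˡ (map φ e) (map φ e′) (trans x≡ x≡′))

  Descent-build : Descent φ n B v bk → (ve : ValidEdge k n e) → ∀ c →
                  Descent φ n ((e , c) ∷ B) v ((map φ e ∷ʳ v , c) ∷ bk)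
  Descent-build {e = e} D ve c = record
    { increasing       = increasing
    ; below            = below
    ; occupants-linked = λ where
        (here refl) e<i i<n → ⊥-elim (ValidEdge-not-below ve i<n e<i)
        (there e∈)  e<i i<n → there (occupants-linked e∈ e<i i<n)
    ; linked           = λ where
        (here refl) → here refl
        (there e∈)  → there (linked e∈)
    ; low-bounded      = Bounded-∷ (ValidEdge-bounded ve) low-bounded
    ; only-links       = λ where
        (here refl) _   → e , c , here refl , refl
        (there x∈)  v∈x → let e′ , c′ , e′∈ , x≡ = only-links x∈ v∈x in e′ , c′ , there e′∈ , x≡
    ; high-bounded     = Bounded-∷ (ValidEdge-bounded (lift-valid D ve)) high-bounded
    }
    where open Descent D

  Descent-extend : Descent φ n B v bk → u < v → (∀ {i} → i < n → φ i < u) → Linked φ u bk B →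
                   Descent (extend φ n u) (suc n) B v bk
  Descent-extend {φ} {n} {B} {v} {bk} {u} D u<v φ<u u-linked = record
    { increasing       = increasing′
    ; below            = below′
    ; occupants-linked = occupants-linked′
    ; linked           = linked′
    ; low-bounded      = Bounded-mono (n≤1+n n) low-bounded
    ; only-links       = only-links′
    ; high-bounded     = high-bounded
    }
    where
    open Descent D
    ψ : ℕ → ℕ
    ψ = extend φ n u

    ψ<n : ∀ {i} → i < n → ψ i ≡ φ i
    ψ<n = extend-< φ

    ψn : ψ n ≡ u
    ψn = extend-≡ φ n u

    lowered : ∀ {e c} → (e , c) ∈ B → map ψ e ≡ map φ e
    lowered e∈ = map-extend φ (low-bounded e∈)

    increasing′ : ∀ {i j} → i < j → j < suc n → ψ i < ψ j
    increasing′ i<j j<1+n with m<1+n⇒m<n∨m≡n j<1+n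
    ... | inj₁ j<n  rewrite ψ<n (<-trans i<j j<n) | ψ<n j<n = increasing i<j j<n
    ... | inj₂ refl rewrite ψ<n i<j | ψn = φ<u i<j

    below′ : ∀ {i} → i < suc n → ψ i < v
    below′ i<1+n with m<1+n⇒m<n∨m≡n i<1+n
    ... | inj₁ i<n  rewrite ψ<n i<n = below i<n
    ... | inj₂ refl rewrite ψn = u<v

    occupants-linked′ : ∀ {e c} → (e , c) ∈ B → ∀ {i} → All (_< i) e → i < suc n →
                        (map ψ e ∷ʳ ψ i , c) ∈ bk
    occupants-linked′ e∈ e<i i<1+n rewrite lowered e∈ with m<1+n⇒m<n∨m≡n i<1+n
    ... | inj₁ i<n  rewrite ψ<n i<n = occupants-linked e∈ e<i i<n
    ... | inj₂ refl rewrite ψn = u-linked e∈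

    linked′ : Linked ψ v bk B
    linked′ e∈ rewrite lowered e∈ = linked e∈

    only-links′ : ∀ {x c} → (x , c) ∈ bk → v ∈ x → ∃₂ λ e c′ → (e , c′) ∈ B × x ≡ map ψ e ∷ʳ v
    only-links′ x∈ v∈x with only-links x∈ v∈x
    ... | e , c′ , e∈ , refl = e , c′ , e∈ , cong (_∷ʳ v) (sym (lowered e∈))

  lift-clique : Descent φ n B v bk → MonoClique k s t B → MonoClique (suc k) (suc s) (suc t) bk
  lift-clique {φ} {n} {B} {v} {bk} D (c , S , S-inc , |S| , S-edges) =
    c , map φ S ∷ʳ v , map-∷ʳ-increasing increasing below S-inc S<n , size-ok , edges
    where
    open Descent D

    S<n : All (_< n) S
    S<n = clique-bounded S 1≤k (subst (k ≤_) (sym |S|) (size-≥ (<⇒≤ k<s) (<⇒≤ k<t) c)) S-inc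
            (λ e e⊆S |e| → low-bounded (S-edges e e⊆S |e|))

    size-ok : length (map φ S ∷ʳ v) ≡ size (suc s) (suc t) c
    size-ok = trans (length-∷ʳ (map φ S) v)
                (trans (cong suc (trans (length-map φ S) |S|)) (sym (size-suc s t c)))

    through-v : ∀ e → e ⊆ map φ S → length (e ∷ʳ v) ≡ suc k → (e ∷ʳ v , c) ∈ bk
    through-v e e⊆φS |e∷v| with ⊆-map⁻ φ S e⊆φS
    ... | e₀ , e₀⊆S , refl = linked (S-edges e₀ e₀⊆S |e₀|)
      where
      |e₀| : length e₀ ≡ k
      |e₀| = trans (sym (length-map φ e₀))
                   (suc-injective (trans (sym (length-∷ʳ (map φ e₀) v)) |e∷v|))

    avoiding-v : ∀ e → e ⊆ map φ S → length e ≡ suc k → (e , c) ∈ bk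
    avoiding-v e e⊆φS |e| with ⊆-map⁻ φ S e⊆φS
    ... | e₁ , e₁⊆S , refl with initLast e₁
    ...   | [] = ⊥-elim (0≢1+n |e|)
    ...   | e₂ ∷ʳ′ i = subst (λ x → (x , c) ∈ bk) (sym (map-++ φ e₂ [ i ]))
                         (occupants-linked (S-edges e₂ e₂⊆S |e₂|) e₂<i i<n)
      where
      e₂⊆S : e₂ ⊆ S
      e₂⊆S = ⊆-trans (++⁺ʳ [ i ] ⊆-refl) e₁⊆S
      |e₂| : length e₂ ≡ k
      |e₂| = suc-injective (trans (sym (length-∷ʳ e₂ i))
                                  (trans (sym (length-map φ (e₂ ∷ʳ i))) |e|))
      e₂<i : All (_< i) e₂
      e₂<i = Increasing-∷ʳ⁻ e₂ (AllPairs-⊆ e₁⊆S S-inc)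
      i<n : i < n
      i<n = proj₂ (Allₚ.∷ʳ⁻ (All-⊆ e₁⊆S S<n))

    edges : ∀ e → e ⊆ map φ S ∷ʳ v → length e ≡ suc k → (e , c) ∈ bk
    edges e e⊆ |e| with ⊆-∷ʳ⁻ (map φ S) e⊆
    ... | inj₁ e⊆φS               = avoiding-v e e⊆φS |e|
    ... | inj₂ (e′ , refl , e′⊆φS) = through-v e′ e′⊆φS |e|

  -- A reveal creates a slot unless the low strategy has already won there: a vertex arriving
  -- at such a reveal wins at once and never needs to occupy it.
  mutual
    slots : Low E n B b → ℕ
    slots (won _)         = 0
    slots (build _ _ _ W) = slots (W zero) + slots (W (suc zero))
    slots (next _ _ W)    = slots⁺ W

    slots⁺ : Low E n B b → ℕ
    slots⁺ (won _)             = 0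
    slots⁺ W@(build _ _ _ _)  = suc (slots W)
    slots⁺ W@(next _ _ _)     = suc (slots W)

  won-or-slot : (W : Low E n B b) → MonoClique k s t B ⊎ slots⁺ W ≡ suc (slots W)
  won-or-slot (won S)         = inj₁ S
  won-or-slot (build _ _ _ _) = inj₂ refl
  won-or-slot (next _ _ _)    = inj₂ refl

  reveal-after-edge : b ≡ true ⊎ n < k → k ≤ n → b ≡ true
  reveal-after-edge (inj₁ b≡true) _   = b≡true
  reveal-after-edge (inj₂ n<k)    k≤n = ⊥-elim (<⇒≱ n<k k≤n)

  -- Once k vertices are revealed every round builds an edge, so a round that starts with E edges
  -- left has at most 2 ^ E - 2 slots.
  mutual
    slots<2^ : (W : Low E n B b) → k ≤ n → slots W < 2 ^ E
    slots<2^ {E = E} (won _)   _   = m^n>0 2 E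
    slots<2^ (build _ _ _ W)   k≤n =
      <-trans (n<1+n _) (1+m+n<2*o (slots<2^ (W zero) k≤n) (slots<2^ (W (suc zero)) k≤n))
    slots<2^ (next p _ W)      k≤n with reveal-after-edge p k≤n
    ... | refl = slots⁺<2^ W (m≤n⇒m≤1+n k≤n)

    slots⁺<2^ : (W : Low E n B false) → k ≤ n → slots⁺ W < 2 ^ E
    slots⁺<2^ {E = E} (won _)  _   = m^n>0 2 E
    slots⁺<2^ (build _ _ _ W)  k≤n =
      1+m+n<2*o (slots<2^ (W zero) k≤n) (slots<2^ (W (suc zero)) k≤n)
    slots⁺<2^ (next p _ _)     k≤n with reveal-after-edge p k≤n
    ... | ()

  -- The occupants u < N of the slots of W, each with the links it built on its way down.
  Filling : Low E n B b → ℕ → Built → (ℕ → ℕ) → Set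
  Filling (won _)         N bk φ = ⊤
  Filling (build _ _ _ W) N bk φ = ∀ c → Filling (W c) N bk φ
  Filling (next {n = n} {built = B} _ _ W) N bk φ =
    Maybe (∃[ u ] (u < N × (∀ {i} → i < n → φ i < u) × Linked φ u bk B ×
                   Filling W N bk (extend φ n u)))

  vacant : (W : Low E n B b) → Filling W N bk φ → ℕ
  vacant (won _)         _ = 0
  vacant (build _ _ _ W) T = vacant (W zero) (T zero) + vacant (W (suc zero)) (T (suc zero))
  vacant (next _ _ W) nothing                   = slots⁺ W
  vacant (next _ _ W) (just (_ , _ , _ , _ , T)) = vacant W T

  unfilled : (W : Low E n B b) → Filling W N bk φ
  unfilled (won _)         = tt
  unfilled (build _ _ _ W) = λ c → unfilled (W c)
  unfilled (next _ _ _)    = nothing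

  vacant-unfilled : (W : Low E n B b) → vacant W (unfilled {N = N} {bk} {φ} W) ≡ slots W
  vacant-unfilled (won _)         = refl
  vacant-unfilled (build _ _ _ W) =
    cong₂ _+_ (vacant-unfilled (W zero)) (vacant-unfilled (W (suc zero)))
  vacant-unfilled (next _ _ _)    = refl

  weaken : (W : Low E n B b) → N ≤ N′ → bk Subset.⊆ bk′ → Filling W N bk φ → Filling W N′ bk′ φ
  weaken (won _)         _    _    _       = tt
  weaken (build _ _ _ W) N≤N′ ⊆bk′ T       = λ c → weaken (W c) N≤N′ ⊆bk′ (T c)
  weaken (next _ _ W)    _    _    nothing = nothing
  weaken (next _ _ W)    N≤N′ ⊆bk′ (just (u , u<N , φ<u , u-linked , T)) =
    just (u , <-≤-trans u<N N≤N′ , φ<u , ⊆bk′ ∘ u-linked , weaken W N≤N′ ⊆bk′ T)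

  vacant-weaken : (W : Low E n B b) (N≤N′ : N ≤ N′) (⊆bk′ : bk Subset.⊆ bk′)
                  (T : Filling W N bk φ) → vacant W (weaken W N≤N′ ⊆bk′ T) ≡ vacant W T
  vacant-weaken (won _)         _    _    _ = refl
  vacant-weaken (build _ _ _ W) N≤N′ ⊆bk′ T =
    cong₂ _+_ (vacant-weaken (W zero) N≤N′ ⊆bk′ (T zero))
              (vacant-weaken (W (suc zero)) N≤N′ ⊆bk′ (T (suc zero)))
  vacant-weaken (next _ _ W)    _    _    nothing                     = refl
  vacant-weaken (next _ _ W)    N≤N′ ⊆bk′ (just (_ , _ , _ , _ , T)) = vacant-weaken W N≤N′ ⊆bk′ T

  refill : (W : (c : Colour) → Low E n ((e , c) ∷ B) true) (c : Colour) → Filling (W c) N′ bk′ φ →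
           (∀ c → Filling (W c) N bk φ) → N ≤ N′ → bk Subset.⊆ bk′ → ∀ c → Filling (W c) N′ bk′ φ
  refill {N′ = N′} {bk′} {φ} W c T′ T N≤N′ ⊆bk′ =
    update {P = λ c′ → Filling (W c′) N′ bk′ φ} c T′ (λ c′ → weaken (W c′) N≤N′ ⊆bk′ (T c′))

  vacant-refill : ∀ {ve : ValidEdge k n e} {e∉ : e ∉ map proj₁ B}
                  (W : (c : Colour) → Low E n ((e , c) ∷ B) true) c
                  {T : ∀ c → Filling (W c) N bk φ} {T′ : Filling (W c) N′ bk′ φ}
                  (N≤N′ : N ≤ N′) (⊆bk′ : bk Subset.⊆ bk′) → vacant (W c) T′ < vacant (W c) (T c) →
                  vacant (build {b = b} e ve e∉ W) (refill W c T′ T N≤N′ ⊆bk′)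
                    < vacant (build {b = b} e ve e∉ W) T
  vacant-refill W zero {T} N≤N′ ⊆bk′ shrunk
    rewrite vacant-weaken (W (suc zero)) N≤N′ ⊆bk′ (T (suc zero)) = +-monoˡ-< _ shrunk
  vacant-refill W (suc zero) {T} N≤N′ ⊆bk′ shrunk
    rewrite vacant-weaken (W zero) N≤N′ ⊆bk′ (T zero) = +-monoʳ-< _ shrunk

  -- How builder continues once the current vertex v has occupied a slot: the occupied slots
  -- are recorded in the new filling, and M edges are reserved for the later vertices.
  Continuation : Low E n B b → (ℕ → ℕ) → ℕ → Built → ℕ → ℕ → Set
  Continuation W φ v bk M r =
    ∀ {E′ bk′} → bk Subset.⊆ bk′ → (T : Filling W (suc v) bk′ φ) → vacant W T < r → M ≤ E′ →
    Bounded bk′ (suc v) → High E′ (suc v) bk′ true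

  descend : (W : Low E n B b) (φ : ℕ → ℕ) (T : Filling W v bk φ) → k ≤ n → Descent φ n B v bk →
            (b ≡ true → bb ≡ true) → E + M ≤ Eₕ → Continuation W φ v bk M (vacant W T) →
            High Eₕ (suc v) bk bb
  descend (won S) _ _ _ D _ _ _ = won (lift-clique D S)
  descend {b = b} {v = v} (build e ve e∉B W) φ T k≤n D _ (s≤s E+M≤Eₕ) continue =
    build (map φ e ∷ʳ v) (lift-valid D ve) (lift-fresh D ve e∉B) λ c →
      descend (W c) φ (weaken (W c) ≤-refl there (T c)) k≤n (Descent-build D ve c) (λ _ → refl)
        E+M≤Eₕ λ ⊆bk′ T′ shrunk →
          continue (⊆bk′ ∘ there) (refill W c T′ T (n≤1+n v) (⊆bk′ ∘ there))
            (vacant-refill {b = b} {ve = ve} {e∉B} W c (n≤1+n v) (⊆bk′ ∘ there)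
              (subst (vacant (W c) T′ <_) (vacant-weaken (W c) ≤-refl there (T c)) shrunk))
  descend {n = n} (next _ _ W) φ (just (u , u<v , φ<u , u-linked , T)) k≤n D _ E+M≤Eₕ continue =
    descend W (extend φ n u) T (m≤n⇒m≤1+n k≤n) (Descent-extend D u<v φ<u u-linked) (λ ()) E+M≤Eₕ
      λ ⊆bk′ T′ → continue ⊆bk′ (just (u , m<n⇒m<1+n u<v , φ<u , ⊆bk′ ∘ u-linked , T′))
  descend {E = E} {n} {v = v} {bk} {M = M} (next p _ W) φ nothing k≤n D b→bb E+M≤Eₕ continue
    with won-or-slot W | b→bb (reveal-after-edge p k≤n)
  ... | inj₁ S    | _    = won (lift-clique D S)
  ... | inj₂ slot | refl =
    continue id (just (v , n<1+n v , below , linked , unfilled W)) first-occupant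
      (≤-trans (m≤n+m M E) E+M≤Eₕ) high-bounded
    where
    open Descent D
    first-occupant : vacant W (unfilled {N = suc v} {bk} {extend φ n v} W) < slots⁺ W
    first-occupant = subst (vacant W (unfilled W) <_) (sym slot)
                       (s≤s (≤-reflexive (vacant-unfilled W)))

  -- Each new vertex either wins or occupies one of the fewer than r vacant slots.
  runVertices : (W : Low E k [] false) (r : ℕ) (T : Filling W N bk id) → vacant W T < r →
                bb ≡ true ⊎ N < suc k → k ≤ N → N + r ≤ V → E * r ≤ Eₕ → Bounded bk N →
                High Eₕ N bk bb
  runVertices {E} {N} {bk} {Eₕ = Eₕ} W (suc r) T (s≤s vacant≤r) round-ok k≤N N+r≤V Er≤Eₕ bk<N =
    next round-ok (≤-trans (m<m+n N (s≤s z≤n)) N+r≤V)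
      (descend W id T ≤-refl (Descent-initial k≤N bk<N) (λ ()) (subst (_≤ Eₕ) (*-suc E r) Er≤Eₕ)
        λ ⊆bk′ T′ shrunk Er≤E′ bk′<N+1 →
          runVertices W r T′ (<-≤-trans shrunk vacant≤r) (inj₁ refl) (m≤n⇒m≤1+n k≤N)
            (≤-trans (≤-reflexive (sym (+-suc N r))) N+r≤V) Er≤E′ bk′<N+1)

  opening : (W : Low E n [] false) → n ≤ k → 2 ^ E + k ≤ suc V → E * 2 ^ E ≤ Eₕ →
            High Eₕ n [] false
  opening (won S) _ _ _ = ⊥-elim (¬MonoClique-[] (<⇒≤ k<s) (<⇒≤ k<t) S)
  opening {E} W@(build _ ve _ _) n≤k vertices edges with ≤-antisym n≤k (ValidEdge-length ve)
  ... | refl = runVertices W (suc (slots W)) (unfilled W) (s≤s (≤-reflexive (vacant-unfilled W)))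
                 (inj₂ ≤-refl) ≤-refl vertices′ (≤-trans (*-monoʳ-≤ E (<⇒≤ few-slots)) edges) (λ ())
    where
    few-slots : suc (slots W) < 2 ^ E
    few-slots = slots⁺<2^ W ≤-refl
    vertices′ : k + suc (slots W) ≤ V
    vertices′ = ≤-pred (≤-trans (+-monoʳ-< k few-slots)
                                (≤-trans (≤-reflexive (+-comm k (2 ^ E))) vertices))
  opening (next (inj₁ ()) _ _)
  opening {E} (next (inj₂ n<k) _ W) _ vertices edges =
    next (inj₂ (m<n⇒m<1+n n<k)) (≤-trans n<k (≤-pred (≤-trans (+-monoˡ-≤ k (m^n>0 2 E)) vertices)))
      (opening W n<k vertices edges)

  lift-strategy : BuilderWins k s t V′ E → 2 ^ E + k ≤ suc V →
                  BuilderWins (suc k) (suc s) (suc t) V (E * 2 ^ E)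
  lift-strategy W vertices = opening W z≤n vertices ≤-refl

theorem1p1 : ∀ (k s t : ℕ) → 2 ≤ k → k < s → k < t →
    ∀ (m : ℕ) → IsOnlineRamseyNumber (k ∸ 1) (s ∸ 1) (t ∸ 1) m →
      BuilderWins k s t (2 ^ m + k ∸ 2) (m * 2 ^ m)
      × (∀ r → IsRamseyNumber k s t r → r ≤ 2 ^ m + k ∸ 2)
      × (∀ r → IsOnlineRamseyNumber k s t r → r ≤ m * 2 ^ m)
theorem1p1 zero          _ _ ()
theorem1p1 (suc zero)    _ _ (s≤s ())
theorem1p1 (suc (suc k)) (suc s) (suc t) _ (s≤s k<s) (s≤s k<t) m ((V′ , W) , _) =
  wins ,
  (λ _ (_ , minimal) →
     minimal _ (BuilderWins⇒Arrows (s≤s z≤n) (m≤n⇒m≤1+n k<s) (m≤n⇒m≤1+n k<t) wins)) ,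
  (λ _ (_ , minimal) → minimal _ (_ , wins))
  where
  V-eq : 2 ^ m + suc (suc k) ∸ 2 ≡ 2 ^ m + k
  V-eq = cong (_∸ 2) (trans (+-suc (2 ^ m) (suc k)) (cong suc (+-suc (2 ^ m) k)))
  wins : BuilderWins (suc (suc k)) (suc s) (suc t) (2 ^ m + suc (suc k) ∸ 2) (m * 2 ^ m)
  wins = Lifting.lift-strategy (suc k) s t V′ _ (s≤s z≤n) k<s k<t W
           (≤-reflexive (trans (+-suc (2 ^ m) k) (cong suc (sym V-eq))))
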